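{- Let $G$ be a finite cubic (every vertex has degree $3$) bridgeless graph embedded on an oriented surface. Let $C$ be a weak Hamiltonian of $G$ with cycles $C_1,\ldots,C_N$, and for each $i$ let $F_i$ be a $1$-factor (perfect matching) of the cycle $C_i$. Then the mutation $\mu_{F_1,\ldots,F_N}(C)=C^{\perp}\cup F_1\cup\cdots\cup F_N$ is a weak Hamiltonian of $G$.
   Context: A weak Hamiltonian of a cubic graph $G$ is a $2$-factor of $G$ (spanning subgraph in which every vertex has degree $2$, i.e. a vertex-disjoint union of cycles covering all vertices) all of whose cycles have even length. For a weak Hamiltonian $C$, $C^{\perp}$ denotes its complement, i.e. the set of edges of $G$ not in $C$, which is a $1$-factor of $G$. Given $1$-factors $F_i$ of the (even) cycles $C_i$ of $C$, the $(F_1,\ldots,F_N)$ mutation of $C$ is the spanning subgraph $\mu_{F_1,\ldots,F_N}(C)$ whose edge set is $C^{\perp}\cup F_1\cup\cdots\cup F_N$. -}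

module Defs where

open import Data.Nat using (ℕ; zero; suc; _+_)
open import Data.Nat.Divisibility using (_∣_)
open import Data.Fin using (Fin; _≟_)
open import Data.Bool using (Bool; true; false; not; _∨_; if_then_else_)
open import Data.Product using (Σ; ∃; ∃-syntax; _×_; _,_)
open import Data.Sum using (_⊎_)
open import Data.List using (List; length; map; allFin)
open import Data.Nat.ListAction using (sum)
open import Data.List.Relation.Unary.Unique.Propositional using (Unique)
open import Data.List.Membership.Propositional using (_∈_)
open import Function.Bundles using (_⇔_)
open import Relation.Nullary using (does)
open import Relation.Binary.PropositionalEquality using (_≡_)
open import Relation.Binary.Construct.Closure.ReflexiveTransitive using (Star)

record Graph : Set where
  field
    nV  : ℕ
    nE  : ℕ
    src : Fin nE → Fin nV
    tgt : Fin nE → Fin nV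
open Graph public

Vertex : Graph → Set
Vertex G = Fin (nV G)

Edge : Graph → Set
Edge G = Fin (nE G)

EdgeSet : Graph → Set
EdgeSet G = Edge G → Bool

allEdges : (G : Graph) → EdgeSet G
allEdges G e = true

-- number of ends of edge e at vertex v (a loop counts twice)
endsAt : (G : Graph) → Edge G → Vertex G → ℕ
endsAt G e v = (if does (src G e ≟ v) then 1 else 0)
             + (if does (tgt G e ≟ v) then 1 else 0)

deg : (G : Graph) → EdgeSet G → Vertex G → ℕ
deg G S v = sum (map (λ e → if S e then endsAt G e v else 0) (allFin (nE G)))

IsCubic : Graph → Set
IsCubic G = ∀ v → deg G (allEdges G) v ≡ 3

Adj : (G : Graph) → EdgeSet G → Vertex G → Vertex G → Set
Adj G S u v = ∃[ e ] (S e ≡ true ×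
  ((src G e ≡ u × tgt G e ≡ v) ⊎ (src G e ≡ v × tgt G e ≡ u)))

Reach : (G : Graph) → EdgeSet G → Vertex G → Vertex G → Set
Reach G S = Star (Adj G S)

without : (G : Graph) → Edge G → EdgeSet G
without G e f = not (does (f ≟ e))

IsBridgeless : Graph → Set
IsBridgeless G = ∀ e → Reach G (without G e) (src G e) (tgt G e)

_ᶜ : {G : Graph} → EdgeSet G → EdgeSet G
(S ᶜ) e = not (S e)

_∪_ : {G : Graph} → EdgeSet G → EdgeSet G → EdgeSet G
(S ∪ T) e = S e ∨ T e

_⊆_ : {G : Graph} → EdgeSet G → EdgeSet G → Set
_⊆_ {G} S T = ∀ (e : Edge G) → S e ≡ true → T e ≡ true

Is2Factor : (G : Graph) → EdgeSet G → Set
Is2Factor G S = ∀ v → deg G S v ≡ 2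

Is1FactorOf : (G : Graph) → EdgeSet G → EdgeSet G → Set
Is1FactorOf G S F = _⊆_ {G} F S × (∀ v → deg G F v ≡ 1)

-- the cycle (connected component) of S through v has even length:
-- its vertex set, listed without repetition, has even cardinality
CycleThroughEven : (G : Graph) → EdgeSet G → Vertex G → Set
CycleThroughEven G S v = Σ (List (Vertex G)) λ xs →
  Unique xs × (∀ w → (w ∈ xs) ⇔ Reach G S v w) × (2 ∣ length xs)

IsWeakHamiltonian : (G : Graph) → EdgeSet G → Set
IsWeakHamiltonian G C = Is2Factor G C × (∀ v → CycleThroughEven G C v)

-- mutation  μ_F(C) = C^⊥ ∪ F,  where F = F₁ ∪ … ∪ F_N
mutation : (G : Graph) → EdgeSet G → EdgeSet G → EdgeSet G
mutation G C F = _∪_ {G} (_ᶜ {G} C) F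

-- Embedding on an oriented surface, given combinatorially by a rotation
-- system: a permutation ρ of the darts (half-edges) fixing the vertex of
-- each dart and acting cyclically (transitively) on the darts at each vertex.
Dart : Graph → Set
Dart G = Edge G × Bool

dartVertex : (G : Graph) → Dart G → Vertex G
dartVertex G (e , false) = src G e
dartVertex G (e , true)  = tgt G e

iter : {A : Set} → (A → A) → ℕ → A → A
iter f zero    x = x
iter f (suc k) x = f (iter f k x)

record RotationSystem (G : Graph) : Set where
  field
    ρ        : Dart G → Dart G
    ρ⁻¹      : Dart G → Dart G
    ρ-inv₁   : ∀ d → ρ (ρ⁻¹ d) ≡ d
    ρ-inv₂   : ∀ d → ρ⁻¹ (ρ d) ≡ d
    ρ-vertex : ∀ d → dartVertex G (ρ d) ≡ dartVertex G d
    ρ-cyclic : ∀ d d' → dartVertex G d ≡ dartVertex G d' →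
               ∃[ k ] (iter ρ k d ≡ d')

-- Since C is a 2-factor of a cubic graph, its complement A = C^⊥ is a perfect
-- matching, and F is a perfect matching disjoint from A; so every vertex has
-- degree 1 + 1 in A ∪ F.  Each vertex v has an A-mate a(v) and an F-mate f(v),
-- both involutions, and the component of v in A ∪ F is the orbit of v and a(v)
-- under the injection f ∘ a of the finite vertex set.  That orbit is finite and
-- closed under the fixed-point-free involution a, hence has even size.
module Submission where

open import Defs
open import Data.Bool using (true; false; not; _∨_; if_then_else_)
open import Data.Bool.Properties using (∨-zeroʳ; ∨-inverseʳ; not-injective)
open import Data.Fin using (Fin; toℕ; _≟_)
open import Data.Fin.Properties using (pigeonhole)
open import Data.List using (List; []; _∷_; length; map; allFin; filter)
open import Data.List.Properties using (map-cong; filter-all; filter-reject)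
open import Data.List.Membership.Propositional using (_∈_)
open import Data.List.Membership.Propositional.Properties using (∈-filter⁺; ∈-filter⁻; ∈-allFin)
open import Data.List.Relation.Unary.All using (lookup)
import Data.List.Relation.Unary.All as All
open import Data.List.Relation.Unary.Any using (here; there)
open import Data.List.Relation.Unary.AllPairs using (_∷_)
open import Data.List.Relation.Unary.Unique.Propositional using (Unique)
open import Data.List.Relation.Unary.Unique.Propositional.Properties using (filter⁺; allFin⁺)
open import Data.Nat using (ℕ; zero; suc; _+_; _<_; z<s; s≤s)
open import Data.Nat.Divisibility using (_∣_; _∣0; ∣-refl; ∣m∣n⇒∣m+n)
open import Data.Nat.ListAction using (sum)
open import Data.Nat.Properties
  using (+-commutativeSemigroup; +-identityʳ; +-suc; suc-injective; n<1+n; ≤-refl; <-trans; m≤n⇒m<n∨m≡n; m≤n⇒∃[o]m+o≡n; anyUpTo?)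
open import Algebra.Properties.CommutativeSemigroup +-commutativeSemigroup using (interchange)
open import Data.Product using (∃-syntax; _×_; _,_; proj₁; proj₂)
open import Data.Sum using (_⊎_; inj₁; inj₂)
open import Function using (_∘_)
open import Function.Bundles using (_⇔_; mk⇔)
open import Function.Definitions using (Injective)
open import Relation.Binary.Construct.Closure.ReflexiveTransitive using (ε; _◅_; _◅◅_)
open import Relation.Binary.Definitions using (DecidableEquality)
open import Relation.Binary.PropositionalEquality using (_≡_; _≢_; refl; sym; trans; cong; cong₂; subst; module ≡-Reasoning)
open import Relation.Nullary using (Dec; yes; no; does; ¬?; contradiction)
open import Relation.Nullary.Decidable using (map′)

module _ {A : Set} where

  sum-map-+ : (g h : A → ℕ) (xs : List A) →
              sum (map (λ x → g x + h x) xs) ≡ sum (map g xs) + sum (map h xs)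
  sum-map-+ g h []       = refl
  sum-map-+ g h (x ∷ xs) = begin
    g x + h x + sum (map (λ x → g x + h x) xs)          ≡⟨ cong (g x + h x +_) (sum-map-+ g h xs) ⟩
    g x + h x + (sum (map g xs) + sum (map h xs))       ≡⟨ interchange (g x) (h x) _ _ ⟩
    g x + sum (map g xs) + (h x + sum (map h xs))       ∎
    where open ≡-Reasoning

  sum-map≡0 : (g : A → ℕ) (xs : List A) → sum (map g xs) ≡ 0 → ∀ {y} → y ∈ xs → g y ≡ 0
  sum-map≡0 g (x ∷ xs) s (here refl) with g x
  ... | zero = refl
  sum-map≡0 g (x ∷ xs) s (there y∈xs) with g x
  ... | zero = sum-map≡0 g xs s y∈xs

  sum-map≡1 : (g : A → ℕ) (xs : List A) → sum (map g xs) ≡ 1 →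
              ∃[ x ] (g x ≡ 1 × ∀ {y} → y ∈ xs → g y ≢ 0 → y ≡ x)
  sum-map≡1 g (x ∷ xs) s with g x in gx
  ... | zero =
    let y , gy , unique = sum-map≡1 g xs s in
    y , gy , λ { (here refl) gx≢0 → contradiction gx gx≢0 ; (there z∈xs) → unique z∈xs }
  ... | suc zero = x , gx , λ
    { (here refl) _      → refl
    ; (there y∈xs) gy≢0 → contradiction (sum-map≡0 g xs (suc-injective s) y∈xs) gy≢0 }

module InvolutionClosed {A : Set} (_≟A_ : DecidableEquality A) (a : A → A)
  (a-involutive : ∀ x → a (a x) ≡ x) (a-≢ : ∀ x → a x ≢ x) where

  ≢? : ∀ x y → Dec (y ≢ x)
  ≢? x y = ¬? (y ≟A x)

  remove : A → List A → List A
  remove x = filter (≢? x)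

  length-remove : ∀ {x} xs → Unique xs → x ∈ xs → suc (length (remove x xs)) ≡ length xs
  length-remove {x} (y ∷ ys) (y∉ys ∷ _) (here refl) =
    cong (λ zs → suc (length zs)) (trans (filter-reject (≢? x) (λ ¬x≡x → ¬x≡x refl))
                                         (filter-all (≢? x) (All.map (λ y≢x → y≢x ∘ sym) y∉ys)))
  length-remove {x} (y ∷ ys) (y∉ys ∷ u) (there x∈ys) with y ≟A x
  ... | yes refl = contradiction refl (lookup y∉ys x∈ys)
  ... | no _     = cong suc (length-remove ys u x∈ys)

  Closed : List A → Set
  Closed xs = ∀ {y} → y ∈ xs → a y ∈ xs

  2∣length : ∀ n {xs} → length xs ≡ n → Unique xs → Closed xs → 2 ∣ n
  2∣length zero _ _ _ = 2 ∣0
  2∣length (suc n) {x ∷ ys} len (x∉ys ∷ u) closed with closed (here refl)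
  ... | here ax≡x   = contradiction ax≡x (a-≢ x)
  ... | there ax∈ys = 2∣suc n (trans (length-remove ys u ax∈ys) (suc-injective len))
    where
    zs : List A
    zs = remove (a x) ys

    a-closed : Closed zs
    a-closed y∈zs with ∈-filter⁻ (≢? (a x)) {xs = ys} y∈zs
    ... | y∈ys , y≢ax with closed (there y∈ys)
    ... | here ay≡x    = contradiction (trans (sym (a-involutive _)) (cong a ay≡x)) y≢ax
    ... | there ay∈ys  = ∈-filter⁺ (≢? (a x)) ay∈ys
      (λ ay≡ax → lookup x∉ys y∈ys (trans (sym (a-involutive x)) (trans (cong a (sym ay≡ax)) (a-involutive _))))

    2∣suc : ∀ n → suc (length zs) ≡ n → 2 ∣ suc n
    2∣suc (suc m) e = ∣m∣n⇒∣m+n ∣-refl (2∣length m (suc-injective e) (filter⁺ (≢? (a x)) u) a-closed)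

iter-+ : {A : Set} (p : A → A) (m n : ℕ) (x : A) → iter p (m + n) x ≡ iter p m (iter p n x)
iter-+ p zero    n x = refl
iter-+ p (suc m) n x = cong p (iter-+ p m n x)

iter-injective : {A : Set} {p : A → A} → Injective _≡_ _≡_ p → ∀ k → Injective _≡_ _≡_ (iter p k)
iter-injective p-inj zero    eq = eq
iter-injective p-inj (suc k) eq = iter-injective p-inj k (p-inj eq)

injective⇒periodic : ∀ {n} {p : Fin n → Fin n} → Injective _≡_ _≡_ p →
                     ∀ x → ∃[ P ] (iter p (suc P) x ≡ x)
injective⇒periodic {n} {p} p-inj x
  with i , j , i<j , eq ← pigeonhole (n<1+n n) (λ i → iter p (toℕ i) x)
  with P , i+1+P≡j ← m≤n⇒∃[o]m+o≡n i<j
  = P , iter-injective p-inj (toℕ i) (begin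
    iter p (toℕ i) (iter p (suc P) x) ≡⟨ iter-+ p (toℕ i) (suc P) x ⟨
    iter p (toℕ i + suc P) x          ≡⟨ cong (λ k → iter p k x) (trans (+-suc (toℕ i) P) i+1+P≡j) ⟩
    iter p (toℕ j) x                  ≡⟨ eq ⟨
    iter p (toℕ i) x                  ∎)
  where open ≡-Reasoning

module _ (G : Graph) where

  Joins : Edge G → Vertex G → Vertex G → Set
  Joins e u w = (src G e ≡ u × tgt G e ≡ w) ⊎ (src G e ≡ w × tgt G e ≡ u)

  Joins-sym : ∀ {e u w} → Joins e u w → Joins e w u
  Joins-sym (inj₁ (s , t)) = inj₂ (s , t)
  Joins-sym (inj₂ (s , t)) = inj₁ (s , t)

  other : Edge G → Vertex G → Vertex G
  other e v = if does (src G e ≟ v) then tgt G e else src G e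

  -- endsAt G e v ≡ 1 says that e is incident with v and is not a loop.
  endsAt≡1⇒Joins : ∀ e v → endsAt G e v ≡ 1 → Joins e v (other e v)
  endsAt≡1⇒Joins e v h with src G e ≟ v | tgt G e ≟ v
  ... | yes s | no _ = inj₁ (s , refl)
  ... | no _  | yes t = inj₂ (refl , t)

  endsAt≡1⇒other≢ : ∀ e v → endsAt G e v ≡ 1 → other e v ≢ v
  endsAt≡1⇒other≢ e v h with src G e ≟ v | tgt G e ≟ v
  ... | yes _ | no t = t
  ... | no s  | yes _ = s

  Joins⇒≡other : ∀ e {u w} → endsAt G e u ≡ 1 → Joins e u w → w ≡ other e u
  Joins⇒≡other e {u} h j with src G e ≟ u | tgt G e ≟ u | j
  ... | yes _ | no _  | inj₁ (_ , t) = sym t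
  ... | yes _ | no t′ | inj₂ (_ , t) = contradiction t t′
  ... | no s′ | yes _ | inj₁ (s , _) = contradiction s s′
  ... | no _  | yes _ | inj₂ (s , _) = sym s

  Joins⇒endsAt≢0 : ∀ e {u w} → Joins e u w → endsAt G e u ≢ 0
  Joins⇒endsAt≢0 e {u} j with src G e ≟ u | tgt G e ≟ u | j
  ... | yes _ | _     | _            = λ ()
  ... | no _  | yes _ | _            = λ ()
  ... | no s′ | no _  | inj₁ (s , _) = contradiction s s′
  ... | no _  | no t′ | inj₂ (_ , t) = contradiction t t′

module _ {G : Graph} where

  Adj-sym : ∀ {S u w} → Adj G S u w → Adj G S w u
  Adj-sym (e , Se , j) = e , Se , Joins-sym G j

  Adj-mono : ∀ {S T u w} → _⊆_ {G} S T → Adj G S u w → Adj G T u w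
  Adj-mono S⊆T (e , Se , j) = e , S⊆T e Se , j

module _ {G : Graph} where

  incidence : EdgeSet G → Vertex G → Edge G → ℕ
  incidence S v e = if S e then endsAt G e v else 0

  deg-cong : ∀ {S T} → (∀ e → S e ≡ T e) → ∀ v → deg G S v ≡ deg G T v
  deg-cong S≗T v = cong sum (map-cong (λ e → cong (λ b → if b then endsAt G e v else 0) (S≗T e)) (allFin _))

  deg-∪ : ∀ {S T} → (∀ e → T e ≡ true → S e ≡ false) →
          ∀ v → deg G (_∪_ {G} S T) v ≡ deg G S v + deg G T v
  deg-∪ {S} {T} disjoint v =
    trans (cong sum (map-cong split (allFin _))) (sum-map-+ (incidence S v) (incidence T v) (allFin _))
    where
    split : ∀ e → incidence (_∪_ {G} S T) v e ≡ incidence S v e + incidence T v e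
    split e with S e in Se | T e in Te
    ... | false | false = refl
    ... | false | true  = refl
    ... | true  | false = sym (+-identityʳ _)
    ... | true  | true  = contradiction (trans (sym Se) (disjoint e Te)) λ ()

  deg-ᶜ : ∀ S v → deg G S v + deg G (_ᶜ {G} S) v ≡ deg G (allEdges G) v
  deg-ᶜ S v = trans (sym (deg-∪ (λ e → not-injective) v)) (deg-cong (λ e → ∨-inverseʳ (S e)) v)

IsPerfectMatching : (G : Graph) → EdgeSet G → Set
IsPerfectMatching G S = ∀ v → deg G S v ≡ 1

module PerfectMatching {G : Graph} (S : EdgeSet G) (perfect : IsPerfectMatching G S) where

  private
    matched : ∀ v → ∃[ e ] (S e ≡ true × endsAt G e v ≡ 1 ×
                            ∀ e′ → S e′ ≡ true → endsAt G e′ v ≢ 0 → e′ ≡ e)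
    matched v with sum-map≡1 (incidence {G} S v) (allFin _) (perfect v)
    ... | e , ie≡1 , unique with S e in Se
    ... | true  = e , Se , ie≡1 , λ e′ Se′ →
      unique (∈-allFin e′) ∘ subst (λ b → (if b then endsAt G e′ v else 0) ≢ 0) (sym Se′)

    edge : Vertex G → Edge G
    edge v = proj₁ (matched v)

  -- Kept opaque: unfolding mate in the orbit argument below makes unification blow up.
  opaque
    mate : Vertex G → Vertex G
    mate v = other G (edge v) v

    Adj-mate : ∀ v → Adj G S v (mate v)
    Adj-mate v = let _ , Se , h , _ = matched v in edge v , Se , endsAt≡1⇒Joins G (edge v) v h

    Adj⇒≡mate : ∀ {u w} → Adj G S u w → w ≡ mate u
    Adj⇒≡mate {u} (e , Se , j) with _ , _ , h , unique ← matched u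
      with refl ← unique e Se (Joins⇒endsAt≢0 G e j)
      = Joins⇒≡other G e h j

    mate-≢ : ∀ v → mate v ≢ v
    mate-≢ v = let _ , _ , h , _ = matched v in endsAt≡1⇒other≢ G (edge v) v h

  mate-involutive : ∀ v → mate (mate v) ≡ v
  mate-involutive v = sym (Adj⇒≡mate (Adj-sym (Adj-mate v)))

cycleThroughEven : (G : Graph) (S : EdgeSet G) (v : Vertex G) →
  (∀ w → Dec (Reach G S v w)) →
  (a : Vertex G → Vertex G) → (∀ w → a (a w) ≡ w) → (∀ w → a w ≢ w) →
  (∀ {w} → Reach G S v w → Reach G S v (a w)) →
  CycleThroughEven G S v
cycleThroughEven G S v reach? a a-involutive a-≢ a-reach =
  component , unique , membership ,
  2∣length (length component) refl unique
    (λ w∈ → ∈-filter⁺ reach? (∈-allFin _) (a-reach (proj₂ (∈-filter⁻ reach? {xs = allFin _} w∈))))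
  where
  open InvolutionClosed _≟_ a a-involutive a-≢
  component : List (Vertex G)
  component = filter reach? (allFin (nV G))
  unique : Unique component
  unique = filter⁺ reach? (allFin⁺ (nV G))
  membership : ∀ w → (w ∈ component) ⇔ Reach G S v w
  membership w = mk⇔ (proj₂ ∘ ∈-filter⁻ reach? {xs = allFin _}) (∈-filter⁺ reach? (∈-allFin w))

module UnionOfPerfectMatchings {G : Graph} (A F : EdgeSet G)
  (A-perfect : IsPerfectMatching G A) (F-perfect : IsPerfectMatching G F) where

  open PerfectMatching {G} A A-perfect
    renaming (mate to a; Adj-mate to Adj-a; Adj⇒≡mate to Adj⇒≡a; mate-involutive to a-involutive; mate-≢ to a-≢)
  open PerfectMatching {G} F F-perfect
    renaming (mate to f; Adj-mate to Adj-f; Adj⇒≡mate to Adj⇒≡f; mate-involutive to f-involutive)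

  M : EdgeSet G
  M = _∪_ {G} A F

  Adj-M-a : ∀ v → Adj G M v (a v)
  Adj-M-a v = Adj-mono (λ e Ae → cong (_∨ F e) Ae) (Adj-a v)

  Adj-M-f : ∀ v → Adj G M v (f v)
  Adj-M-f v = Adj-mono (λ e Fe → trans (cong (A e ∨_) Fe) (∨-zeroʳ (A e))) (Adj-f v)

  Adj-M⇒a⊎f : ∀ {u w} → Adj G M u w → w ≡ a u ⊎ w ≡ f u
  Adj-M⇒a⊎f (e , Me , j) with A e in Ae
  ... | true  = inj₁ (Adj⇒≡a (e , Ae , j))
  ... | false = inj₂ (Adj⇒≡f (e , Me , j))

  step : Vertex G → Vertex G
  step = f ∘ a

  step-injective : Injective _≡_ _≡_ step
  step-injective {x} {y} eq = begin
    x              ≡⟨ a-involutive x ⟨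
    a (a x)        ≡⟨ cong a (f-involutive (a x)) ⟨
    a (f (step x)) ≡⟨ cong (a ∘ f) eq ⟩
    a (f (step y)) ≡⟨ cong a (f-involutive (a y)) ⟩
    a (a y)        ≡⟨ a-involutive y ⟩
    y              ∎
    where open ≡-Reasoning

  module Component (v : Vertex G) where

    walk : ℕ → Vertex G
    walk k = iter step k v

    P : ℕ
    P = proj₁ (injective⇒periodic step-injective v)

    walk-period : walk (suc P) ≡ v
    walk-period = proj₂ (injective⇒periodic step-injective v)

    -- The component of v is {walk k, a (walk k) | k ≤ P}.
    Visits : Vertex G → ℕ → Set
    Visits w k = walk k ≡ w ⊎ a (walk k) ≡ w

    OnOrbit : Vertex G → Set
    OnOrbit w = ∃[ k ] (k < suc P × Visits w k)

    Adj-OnOrbit : ∀ {u w} → OnOrbit u → Adj G M u w → OnOrbit w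
    Adj-OnOrbit (k , k≤P , visits) adj with visits | Adj-M⇒a⊎f adj
    ... | inj₁ refl | inj₁ refl = k , k≤P , inj₂ refl
    ... | inj₂ refl | inj₁ refl = k , k≤P , inj₁ (sym (a-involutive (walk k)))
    ... | inj₁ refl | inj₂ refl with k
    ...   | zero  = P , ≤-refl , inj₂ (trans (sym (f-involutive (a (walk P)))) (cong f walk-period))
    ...   | suc k = k , <-trans (n<1+n k) k≤P , inj₂ (sym (f-involutive (a (walk k))))
    Adj-OnOrbit (k , s≤s k≤P , _) adj | inj₂ refl | inj₂ refl with m≤n⇒m<n∨m≡n k≤P
    ... | inj₁ k<P  = suc k , s≤s k<P , inj₁ refl
    ... | inj₂ refl = 0 , z<s , inj₁ (sym walk-period)

    Reach⇒OnOrbit : ∀ {u w} → OnOrbit u → Reach G M u w → OnOrbit w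
    Reach⇒OnOrbit o ε          = o
    Reach⇒OnOrbit o (adj ◅ r) = Reach⇒OnOrbit (Adj-OnOrbit o adj) r

    Reach-walk : ∀ k → Reach G M v (walk k)
    Reach-walk zero    = ε
    Reach-walk (suc k) = Reach-walk k ◅◅ (Adj-M-a _ ◅ Adj-M-f _ ◅ ε)

    OnOrbit⇒Reach : ∀ {w} → OnOrbit w → Reach G M v w
    OnOrbit⇒Reach (k , _ , inj₁ refl) = Reach-walk k
    OnOrbit⇒Reach (k , _ , inj₂ refl) = Reach-walk k ◅◅ (Adj-M-a _ ◅ ε)

    Reach? : ∀ w → Dec (Reach G M v w)
    Reach? w = map′ OnOrbit⇒Reach (Reach⇒OnOrbit (0 , z<s , inj₁ refl)) (anyUpTo? visits? (suc P))
      where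
      visits? : ∀ k → Dec (Visits w k)
      visits? k with walk k ≟ w | a (walk k) ≟ w
      ... | yes eq | _      = yes (inj₁ eq)
      ... | no _   | yes eq = yes (inj₂ eq)
      ... | no ¬₁  | no ¬₂  = no λ { (inj₁ eq) → ¬₁ eq ; (inj₂ eq) → ¬₂ eq }

  components-even : ∀ v → CycleThroughEven G M v
  components-even v = cycleThroughEven G M v Reach? a a-involutive a-≢ (λ r → r ◅◅ (Adj-M-a _ ◅ ε))
    where open Component v

mainTheorem1 : (G : Graph) → IsCubic G → IsBridgeless G → RotationSystem G →
    (C : EdgeSet G) → IsWeakHamiltonian G C →
    (F : EdgeSet G) → Is1FactorOf G C F →
    IsWeakHamiltonian G (mutation G C F)
mainTheorem1 G cubic _ _ C (C-2factor , _) F (F⊆C , F-perfect) =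
  M-2factor , UnionOfPerfectMatchings.components-even {G} (_ᶜ {G} C) F Cᶜ-perfect F-perfect
  where
  Cᶜ-perfect : IsPerfectMatching G (_ᶜ {G} C)
  Cᶜ-perfect v = suc-injective (suc-injective (begin
    2 + deg G (_ᶜ {G} C) v                ≡⟨ cong (_+ deg G (_ᶜ {G} C) v) (C-2factor v) ⟨
    deg G C v + deg G (_ᶜ {G} C) v        ≡⟨ deg-ᶜ {G} C v ⟩
    deg G (allEdges G) v                  ≡⟨ cubic v ⟩
    3                                     ∎))
    where open ≡-Reasoning

  M-2factor : Is2Factor G (mutation G C F)
  M-2factor v = begin
    deg G (mutation G C F) v              ≡⟨ deg-∪ {G} (λ e → cong not ∘ F⊆C e) v ⟩
    deg G (_ᶜ {G} C) v + deg G F v        ≡⟨ cong₂ _+_ (Cᶜ-perfect v) (F-perfect v) ⟩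
    2                                     ∎
    where open ≡-Reasoning
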